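{- Let $\delta>0$ and let $m_1,\dots,m_T\in[0,1]$ be the daily costs of the best expert, with total cost $\sum_{i=1}^T m_i\le M$. Let $\mathrm{Bad}\subseteq[T]$ be the set of days $s$ such that the best expert, if added to the pool on day $s$, would be eliminated by Algorithm B, i.e., there exists a day $e\in\{s,\dots,T\}$ such that the average cost of the best expert over days $s,\dots,e$ is higher than $\frac{\delta}{8}$. Then $|\mathrm{Bad}|\le\frac{8M}{\delta}$.
   Context: Online learning with experts with costs in $[0,1]$: $n$ experts, $T$ days, expert $i$ incurs cost $c_i^{(t)}\in[0,1]$ on day $t$; the best expert is one minimizing $\sum_t c_i^{(t)}$. Algorithm B maintains a pool $P$ of experts with a start time $u$, runs a sequential prediction algorithm on $P$, and resamples the pool (setting $u\gets t$) when every expert in $P$ has an error rate (average cost) higher than $\frac{\delta}{8}$ since time $u$.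
   Formalization: The daily costs $m_1,\dots,m_T$ of the best expert, the parameter δ and the total-cost bound M are all taken to be rational numbers. -}

module Defs where

open import Data.Nat using (ℕ; suc; _+_; _∸_)
open import Data.List using (List; map; upTo; foldr; filter)
open import Data.List.Relation.Unary.Any using (Any; any?)
open import Data.Integer using (+_)
open import Data.Rational using (ℚ; 0ℚ; _*_; _/_; _<_; _<?_)
open import Relation.Nullary using (Dec)

sumℚ : List ℚ → ℚ
sumℚ = foldr Data.Rational._+_ 0ℚ

-- the days s, s+1, ..., e  (empty if e < s)
interval : ℕ → ℕ → List ℕ
interval s e = map (λ k → s + k) (upTo (suc e ∸ s))

segSum : (ℕ → ℚ) → ℕ → ℕ → ℚ
segSum m s e = sumℚ (map m (interval s e))

average : (ℕ → ℚ) → ℕ → ℕ → ℚ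
average m s e = segSum m s e * (+ 1 / suc (e ∸ s))

IsBad : (ℕ → ℚ) → ℚ → ℕ → ℕ → Set
IsBad m δ T s = Any (λ e → δ * (+ 1 / 8) < average m s e) (interval s T)

isBad? : (m : ℕ → ℚ) (δ : ℚ) (T s : ℕ) → Dec (IsBad m δ T s)
isBad? m δ T s = any? (λ e → δ * (+ 1 / 8) <? average m s e) (interval s T)

-- the set Bad ⊆ [T] = {1,…,T}, as the (duplicate-free, increasing) list of its elements
Bad : (ℕ → ℚ) → ℚ → ℕ → List ℕ
Bad m δ T = filter (isBad? m δ T) (interval 1 T)

{-# OPTIONS --safe #-}
-- A bad day d opens a block of days d, …, e on which the average cost
-- exceeds δ/8. Scanning [1, T] from the left, jump over the block of each bad day met and
-- step over each good day: the blocks are disjoint, each pays at least δ/8 for every bad day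
-- it contains, and the skipped good days cost at least 0. Hence (δ/8)·|Bad| ≤ Σ m ≤ M.
module Submission where

open import Defs
open import Data.Nat using (ℕ; _≤_)
open import Data.List using (length)
open import Data.Product using (_×_)
open import Data.Integer using (+_)
open import Data.Rational using (ℚ; 0ℚ; 1ℚ; _*_; _/_; _÷_; Positive)
open import Data.Rational.Properties using (pos⇒nonZero)

open import Data.Nat using (zero; suc; _+_; _∸_; _<_; z≤n; s≤s)
import Data.Nat.Properties as ℕ
open import Data.Nat.Induction using (<-wellFounded)
open import Induction.WellFounded using (Acc; acc)
import Data.Integer as ℤ
import Data.Integer.Properties as ℤ
open import Data.Integer.Tactic.RingSolver using (solve-∀)
open import Data.List using (List; []; _∷_; _++_; map; filter; iterate; applyUpTo)
open import Data.List.Properties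
  using (map-++; filter-++; length-++; length-filter; filter-reject; length-iterate; map-applyUpTo)
open import Data.List.Relation.Unary.Any using (Any; here; there)
open import Data.Product using (_,_; proj₁; ∃-syntax)
import Data.Rational as ℚ
open import Data.Rational using (NonNegative; 1/_; toℚᵘ)
open import Data.Rational.Properties
  using ( toℚᵘ-injective; toℚᵘ-fromℚᵘ; toℚᵘ-homo-+; toℚᵘ-homo-*; toℚᵘ-cancel-≤
        ; +-identityˡ; +-identityʳ; +-assoc; *-assoc; *-identityʳ; *-zeroʳ
        ; *-distribˡ-+; *-inverseʳ; *-monoˡ-≤-nonNeg; *-monoʳ-≤-nonNeg; *-monoˡ-<-pos
        ; +-mono-≤; ≤-reflexive; ≤-trans; <⇒≤; <-respʳ-≡
        ; pos⇒nonNeg; pos*pos⇒pos; normalize-pos; 1/pos⇒pos; module ≤-Reasoning)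
open import Data.Rational.Solver using (module +-*-Solver)
import Data.Rational.Unnormalised as ℚᵘ
import Data.Rational.Unnormalised.Properties as ℚᵘ
open import Relation.Binary.PropositionalEquality
open import Relation.Nullary using (Dec; yes; no)
open import Relation.Unary using (Decidable)

fromℕ : ℕ → ℚ
fromℕ n = + n / 1

toℚᵘ-/ : ∀ i k → toℚᵘ (i / suc k) ℚᵘ.≃ ℚᵘ.mkℚᵘ i k
toℚᵘ-/ i k = toℚᵘ-fromℚᵘ (ℚᵘ.mkℚᵘ i k)

fromℕ-+ : ∀ a b → fromℕ (a + b) ≡ fromℕ a ℚ.+ fromℕ b
fromℕ-+ a b = toℚᵘ-injective (begin
  toℚᵘ (fromℕ (a + b))                    ≈⟨ toℚᵘ-/ (+ (a + b)) 0 ⟩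
  ℚᵘ.mkℚᵘ (+ (a + b)) 0                   ≈⟨ ℚᵘ.*≡* (trans (cong (ℤ._* + 1) (ℤ.pos-+ a b)) (cross (+ a) (+ b))) ⟩
  ℚᵘ.mkℚᵘ (+ a) 0 ℚᵘ.+ ℚᵘ.mkℚᵘ (+ b) 0    ≈⟨ ℚᵘ.+-cong (toℚᵘ-/ (+ a) 0) (toℚᵘ-/ (+ b) 0) ⟨
  toℚᵘ (fromℕ a) ℚᵘ.+ toℚᵘ (fromℕ b)      ≈⟨ toℚᵘ-homo-+ (fromℕ a) (fromℕ b) ⟨
  toℚᵘ (fromℕ a ℚ.+ fromℕ b)              ∎)
  where
  open ℚᵘ.≃-Reasoning
  cross : ∀ (x y : ℤ.ℤ) → (x ℤ.+ y) ℤ.* + 1 ≡ (x ℤ.* + 1 ℤ.+ y ℤ.* + 1) ℤ.* + 1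
  cross = solve-∀

fromℕ-mono-≤ : ∀ {a b} → a ≤ b → fromℕ a ℚ.≤ fromℕ b
fromℕ-mono-≤ {a} {b} a≤b = toℚᵘ-cancel-≤ (begin
  toℚᵘ (fromℕ a)      ≃⟨ toℚᵘ-/ (+ a) 0 ⟩
  ℚᵘ.mkℚᵘ (+ a) 0     ≤⟨ ℚᵘ.*≤* (ℤ.*-monoʳ-≤-nonNeg (+ 1) (ℤ.+≤+ a≤b)) ⟩
  ℚᵘ.mkℚᵘ (+ b) 0     ≃⟨ toℚᵘ-/ (+ b) 0 ⟨
  toℚᵘ (fromℕ b)      ∎)
  where open ℚᵘ.≤-Reasoning

1/[1+n]*[1+n]≡1 : ∀ n → (+ 1 / suc n) * fromℕ (suc n) ≡ 1ℚ
1/[1+n]*[1+n]≡1 n = toℚᵘ-injective (begin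
  toℚᵘ ((+ 1 / suc n) * fromℕ (suc n))                  ≈⟨ toℚᵘ-homo-* (+ 1 / suc n) (fromℕ (suc n)) ⟩
  toℚᵘ (+ 1 / suc n) ℚᵘ.* toℚᵘ (fromℕ (suc n))         ≈⟨ ℚᵘ.*-cong (toℚᵘ-/ (+ 1) n) (toℚᵘ-/ (+ suc n) 0) ⟩
  ℚᵘ.mkℚᵘ (+ 1) n ℚᵘ.* ℚᵘ.mkℚᵘ (+ suc n) 0              ≈⟨ ℚᵘ.*≡* (cong ℤ.+[1+_] (ℕ.*-distribʳ-+ 1 n 0)) ⟩
  ℚᵘ.1ℚᵘ                                                ∎)
  where open ℚᵘ.≃-Reasoning

days : ℕ → ℕ → List ℕ
days = iterate suc

days-+ : ∀ s a b → days s (a + b) ≡ days s a ++ days (s + a) b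
days-+ s zero    b = cong (λ t → days t b) (sym (ℕ.+-identityʳ s))
days-+ s (suc a) b = cong (s ∷_) (begin
  days (suc s) (a + b)                    ≡⟨ days-+ (suc s) a b ⟩
  days (suc s) a ++ days (suc s + a) b    ≡⟨ cong (λ t → days (suc s) a ++ days t b) (ℕ.+-suc s a) ⟨
  days (suc s) a ++ days (s + suc a) b    ∎)
  where open ≡-Reasoning

applyUpTo-days : ∀ (f : ℕ → ℕ) s n → (∀ i → f i ≡ s + i) → applyUpTo f n ≡ days s n
applyUpTo-days f s zero    f≗s+ = refl
applyUpTo-days f s (suc n) f≗s+ = cong₂ _∷_ (trans (f≗s+ 0) (ℕ.+-identityʳ s))
  (applyUpTo-days (λ i → f (suc i)) (suc s) n (λ i → trans (f≗s+ (suc i)) (ℕ.+-suc s i)))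

interval-days : ∀ s e → interval s e ≡ days s (suc e ∸ s)
interval-days s e = trans (map-applyUpTo (λ i → i) (λ i → s + i) (suc e ∸ s))
                          (applyUpTo-days (λ i → s + i) s _ (λ _ → refl))

Any-days : ∀ {P : ℕ → Set} s k → Any P (days s k) → ∃[ i ] i < k × P (s + i)
Any-days {P} s (suc k) (here Ps)  = 0 , s≤s z≤n , subst P (sym (ℕ.+-identityʳ s)) Ps
Any-days {P} s (suc k) (there Pxs) with Any-days (suc s) k Pxs
... | i , i<k , P[1+s+i] = suc i , s≤s i<k , subst P (sym (ℕ.+-suc s i)) P[1+s+i]

sumℚ-++ : ∀ xs ys → sumℚ (xs ++ ys) ≡ sumℚ xs ℚ.+ sumℚ ys
sumℚ-++ []       ys = sym (+-identityˡ (sumℚ ys))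
sumℚ-++ (x ∷ xs) ys = trans (cong (x ℚ.+_) (sumℚ-++ xs ys)) (sym (+-assoc x (sumℚ xs) (sumℚ ys)))

total : (ℕ → ℚ) → ℕ → ℕ → ℚ
total w s k = sumℚ (map w (days s k))

total-+ : ∀ w s a b → total w s (a + b) ≡ total w s a ℚ.+ total w (s + a) b
total-+ w s a b = begin
  sumℚ (map w (days s (a + b)))                                ≡⟨ cong (λ xs → sumℚ (map w xs)) (days-+ s a b) ⟩
  sumℚ (map w (days s a ++ days (s + a) b))                    ≡⟨ cong sumℚ (map-++ w (days s a) _) ⟩
  sumℚ (map w (days s a) ++ map w (days (s + a) b))            ≡⟨ sumℚ-++ (map w (days s a)) _ ⟩
  total w s a ℚ.+ total w (s + a) b                            ∎
  where open ≡-Reasoning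

module _ {P : ℕ → Set} (P? : Decidable P) where

  count : ℕ → ℕ → ℕ
  count s k = length (filter P? (days s k))

  count-+ : ∀ s a b → count s (a + b) ≡ count s a + count (s + a) b
  count-+ s a b = begin
    length (filter P? (days s (a + b)))                               ≡⟨ cong (λ xs → length (filter P? xs)) (days-+ s a b) ⟩
    length (filter P? (days s a ++ days (s + a) b))                   ≡⟨ cong length (filter-++ P? (days s a) _) ⟩
    length (filter P? (days s a) ++ filter P? (days (s + a) b))       ≡⟨ length-++ (filter P? (days s a)) ⟩
    count s a + count (s + a) b                                       ∎
    where open ≡-Reasoning

  count≤ : ∀ s k → count s k ≤ k
  count≤ s k = ℕ.≤-trans (length-filter P? (days s k)) (ℕ.≤-reflexive (length-iterate suc s k))

  module _ (w : ℕ → ℚ) (c : ℚ) .{{c≥0 : NonNegative c}} where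

    Charged : ℕ → ℕ → Set
    Charged s k = c * fromℕ (count s k) ℚ.≤ total w s k

    Charged-+ : ∀ s a b → Charged s a → Charged (s + a) b → Charged s (a + b)
    Charged-+ s a b front back = begin
      c * fromℕ (count s (a + b))                          ≡⟨ cong (λ n → c * fromℕ n) (count-+ s a b) ⟩
      c * fromℕ (count s a + count (s + a) b)              ≡⟨ cong (c *_) (fromℕ-+ (count s a) _) ⟩
      c * (fromℕ (count s a) ℚ.+ fromℕ (count (s + a) b))  ≡⟨ *-distribˡ-+ c (fromℕ (count s a)) _ ⟩
      c * fromℕ (count s a) ℚ.+ c * fromℕ (count (s + a) b) ≤⟨ +-mono-≤ front back ⟩
      total w s a ℚ.+ total w (s + a) b                    ≡⟨ total-+ w s a b ⟨
      total w s (a + b)                                    ∎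
      where open ≤-Reasoning

    module _ (lo hi : ℕ)
             (w≥0 : ∀ d → lo ≤ d → d < hi → 0ℚ ℚ.≤ w d)
             (heavy : ∀ d → lo ≤ d → d < hi → P d →
                      ∃[ a ] d + suc a ≤ hi × c * fromℕ (suc a) ℚ.≤ total w d (suc a))
             where

      leading-block : ∀ s k → lo ≤ s → s + suc k ≡ hi → ∃[ a ] a ≤ k × Charged s (suc a)
      leading-block s k lo≤s s+k≡hi = block (P? s)
        where
        s<hi : s < hi
        s<hi = subst (s <_) s+k≡hi (ℕ.m<m+n s (s≤s z≤n))

        block : Dec (P s) → ∃[ a ] a ≤ k × Charged s (suc a)
        block (yes Ps) with heavy s lo≤s s<hi Ps
        ... | a , fits , c[1+a]≤total =
          a , a≤k , ≤-trans (*-monoˡ-≤-nonNeg c (fromℕ-mono-≤ (count≤ s (suc a)))) c[1+a]≤total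
          where
          a≤k : a ≤ k
          a≤k = ℕ.≤-pred (ℕ.+-cancelˡ-≤ s (suc a) (suc k) (subst (s + suc a ≤_) (sym s+k≡hi) fits))
        block (no ¬Ps) = 0 , z≤n , (begin
          c * fromℕ (count s 1)  ≡⟨ cong (λ xs → c * fromℕ (length xs)) (filter-reject P? ¬Ps) ⟩
          c * 0ℚ                 ≡⟨ *-zeroʳ c ⟩
          0ℚ                     ≤⟨ w≥0 s lo≤s s<hi ⟩
          w s                    ≡⟨ +-identityʳ (w s) ⟨
          total w s 1            ∎)
          where open ≤-Reasoning

      charged-acc : ∀ s k → Acc _<_ k → lo ≤ s → s + k ≡ hi → Charged s k
      charged-acc s zero    _             _    _       = ≤-reflexive (*-zeroʳ c)
      charged-acc s (suc k) (acc smaller) lo≤s s+k≡hi with leading-block s k lo≤s s+k≡hi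
      ... | a , a≤k , front = subst (Charged s) 1+a+[k∸a]≡1+k
              (Charged-+ s (suc a) (k ∸ a) front
                 (charged-acc (s + suc a) (k ∸ a) (smaller (s≤s (ℕ.m∸n≤m k a)))
                    (ℕ.≤-trans lo≤s (ℕ.m≤m+n s (suc a))) rest-ends-at-hi))
        where
        1+a+[k∸a]≡1+k : suc a + (k ∸ a) ≡ suc k
        1+a+[k∸a]≡1+k = ℕ.m+[n∸m]≡n (s≤s a≤k)
        rest-ends-at-hi : s + suc a + (k ∸ a) ≡ hi
        rest-ends-at-hi =
          trans (ℕ.+-assoc s (suc a) (k ∸ a)) (trans (cong (λ n → s + n) 1+a+[k∸a]≡1+k) s+k≡hi)

      charged : ∀ s k → lo ≤ s → s + k ≡ hi → Charged s k
      charged s k = charged-acc s k (<-wellFounded k)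

average-days : ∀ m d j → average m d (d + j) ≡ total m d (suc j) * (+ 1 / suc j)
average-days m d j = cong₂ (λ xs n → sumℚ (map m xs) * (+ 1 / suc n))
  (trans (interval-days d (d + j)) (cong (days d) [1+d+j]∸d≡1+j)) (ℕ.m+n∸m≡n d j)
  where
  [1+d+j]∸d≡1+j : suc (d + j) ∸ d ≡ suc j
  [1+d+j]∸d≡1+j = trans (cong (_∸ d) (sym (ℕ.+-suc d j))) (ℕ.m+n∸m≡n d (suc j))

<-*1/[1+n]⇒*[1+n]< : ∀ {p q} n → p ℚ.< q * (+ 1 / suc n) → p * fromℕ (suc n) ℚ.< q
<-*1/[1+n]⇒*[1+n]< {p} {q} n p<q/[1+n] =
  <-respʳ-≡ q/[1+n]*[1+n]≡q (*-monoˡ-<-pos (fromℕ (suc n)) {{normalize-pos (suc n) 1}} p<q/[1+n])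
  where
  q/[1+n]*[1+n]≡q : q * (+ 1 / suc n) * fromℕ (suc n) ≡ q
  q/[1+n]*[1+n]≡q = trans (*-assoc q _ _) (trans (cong (q *_) (1/[1+n]*[1+n]≡1 n)) (*-identityʳ q))

bad-day-starts-heavy-block : ∀ m δ T d → d < suc T → IsBad m δ T d →
  ∃[ a ] d + suc a ≤ suc T × δ * (+ 1 / 8) * fromℕ (suc a) ℚ.≤ total m d (suc a)
bad-day-starts-heavy-block m δ T d d<1+T bad
  with Any-days d (suc T ∸ d) (subst (Any (λ e → δ * (+ 1 / 8) ℚ.< average m d e)) (interval-days d T) bad)
... | j , j<1+T∸d , above = j , fits ,
  <⇒≤ (<-*1/[1+n]⇒*[1+n]< j (subst (δ * (+ 1 / 8) ℚ.<_) (average-days m d j) above))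
  where
  fits : d + suc j ≤ suc T
  fits = ℕ.≤-trans (ℕ.+-monoʳ-≤ d j<1+T∸d) (ℕ.≤-reflexive (ℕ.m+[n∸m]≡n (ℕ.<⇒≤ d<1+T)))

δ/8*n≤M⇒n≤8M/δ : ∀ δ M n .{{_ : Positive δ}} →
  δ * (+ 1 / 8) * n ℚ.≤ M → n ℚ.≤ _÷_ ((+ 8 / 1) * M) δ {{pos⇒nonZero δ}}
δ/8*n≤M⇒n≤8M/δ δ M n δn/8≤M = begin
  n                                        ≡⟨ cancel ⟨
  δ * (+ 1 / 8) * n * ((+ 8 / 1) * 1/δ)    ≤⟨ *-monoʳ-≤-nonNeg ((+ 8 / 1) * 1/δ) {{8/δ≥0}} δn/8≤M ⟩
  M * ((+ 8 / 1) * 1/δ)                    ≡⟨ solve 3 (λ M e g → M :* (e :* g) := e :* M :* g) refl M (+ 8 / 1) 1/δ ⟩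
  (+ 8 / 1) * M * 1/δ                      ∎
  where
  open ≤-Reasoning
  open +-*-Solver
  instance _ = pos⇒nonZero δ
  1/δ : ℚ
  1/δ = 1/ δ
  8/δ≥0 : NonNegative ((+ 8 / 1) * 1/δ)
  8/δ≥0 = pos⇒nonNeg ((+ 8 / 1) * 1/δ) {{pos*pos⇒pos (+ 8 / 1) 1/δ {{1/pos⇒pos δ}}}}
  cancel : δ * (+ 1 / 8) * n * ((+ 8 / 1) * 1/δ) ≡ n
  cancel = begin-equality
    δ * (+ 1 / 8) * n * ((+ 8 / 1) * 1/δ)     ≡⟨ solve 5 (λ δ e n f g → δ :* e :* n :* (f :* g) := n :* ((δ :* g) :* (e :* f)))
                                                         refl δ (+ 1 / 8) n (+ 8 / 1) 1/δ ⟩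
    n * ((δ * 1/δ) * ((+ 1 / 8) * (+ 8 / 1)))  ≡⟨ cong (λ x → n * (x * 1ℚ)) (*-inverseʳ δ) ⟩
    n * (1ℚ * 1ℚ)                              ≡⟨ *-identityʳ n ⟩
    n                                          ∎

lemma3p3 : (T : ℕ) (m : ℕ → ℚ) (δ M : ℚ) → .{{_ : Positive δ}} →
    (∀ i → 1 ≤ i → i ≤ T → (0ℚ Data.Rational.≤ m i) × (m i Data.Rational.≤ 1ℚ)) →
    segSum m 1 T Data.Rational.≤ M →
    (+ length (Bad m δ T) / 1) Data.Rational.≤ _÷_ ((+ 8 / 1) * M) δ {{pos⇒nonZero δ}}
lemma3p3 T m δ M costs∈[0,1] total≤M =
  δ/8*n≤M⇒n≤8M/δ δ M (fromℕ (length (Bad m δ T))) (≤-trans bad-days-charged total≤M)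
  where
  instance
    δ/8≥0 : NonNegative (δ * (+ 1 / 8))
    δ/8≥0 = pos⇒nonNeg (δ * (+ 1 / 8)) {{pos*pos⇒pos δ (+ 1 / 8)}}

  cost≥0 : ∀ d → 1 ≤ d → d < suc T → 0ℚ ℚ.≤ m d
  cost≥0 d 1≤d d<1+T = proj₁ (costs∈[0,1] d 1≤d (ℕ.≤-pred d<1+T))

  days-charged : Charged (isBad? m δ T) m (δ * (+ 1 / 8)) 1 T
  days-charged = charged (isBad? m δ T) m (δ * (+ 1 / 8)) 1 (suc T) cost≥0
    (λ d _ d<1+T → bad-day-starts-heavy-block m δ T d d<1+T) 1 T ℕ.≤-refl refl

  bad-days-charged : δ * (+ 1 / 8) * fromℕ (length (Bad m δ T)) ℚ.≤ segSum m 1 T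
  bad-days-charged =
    subst (λ xs → δ * (+ 1 / 8) * fromℕ (length (filter (isBad? m δ T) xs)) ℚ.≤ sumℚ (map m xs))
          (sym (interval-days 1 T)) days-charged
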